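{- Let $r\ge1$, $s\ge1$ and $0\le t\le s-1$. The map $(i,j)\mapsto(r-i+1,\,s-j+1)$ on $V(T(r,s,t))$ induces an automorphism of $T(r,s,t)$.
   Context: $T(r,s,t)$: vertex set $\{(i,j):1\le i\le r,\ 1\le j\le s\}$, first coordinate modulo $r$, second modulo $s$. For $1<i<r$, $(i,j)$ is adjacent to $(i,j\pm1)$, $(i\pm1,j)$, $(i\pm1,j\mp1)$. If $r>1$, $(1,j)$ is adjacent to $(1,j\pm1)$, $(2,j)$, $(2,j-1)$, $(r,j+t+1)$, $(r,j+t)$, and $(r,j)$ is adjacent to $(r,j\pm1)$, $(r-1,j+1)$, $(r-1,j)$, $(1,j-t)$, $(1,j-t-1)$. If $r=1$, $(1,j)$ is adjacent to $(1,j\pm1)$, $(1,j\pm t)$, $(1,j\pm(t+1))$. (Edges are counted with multiplicity, so $T(r,s,t)$ may be a multigraph.) -}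

module Defs where

open import Data.Nat using (ℕ; zero; suc; _+_; _∸_; _≡ᵇ_; NonZero)
open import Data.Nat.DivMod using (_%_; _mod_)
open import Data.Fin using (Fin; toℕ; opposite)
import Data.Fin.Properties as FinP
open import Data.Product using (_×_; _,_)
open import Data.Product.Properties using (≡-dec)
open import Data.List using (List; []; _∷_; filter; length)
open import Data.Bool using (if_then_else_)
open import Relation.Binary.PropositionalEquality using (_≡_)
open import Relation.Binary.Definitions using (DecidableEquality)
open import Function.Definitions using (Bijective)

-- Vertices of T(r,s,t), 0-indexed: (i , j) stands for the paper's (i+1 , j+1).
Vertex : ℕ → ℕ → Set
Vertex r s = Fin r × Fin s

_≟V_ : ∀ {r s} → DecidableEquality (Vertex r s)
_≟V_ = ≡-dec FinP._≟_ FinP._≟_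

module _ (r s t : ℕ) .{{_ : NonZero r}} .{{_ : NonZero s}} where

  plus : ℕ → ℕ → Fin s
  plus j d = (j + d) mod s

  -- column j - d  (mod s)
  minus : ℕ → ℕ → Fin s
  minus j d = (j + (s ∸ (d % s))) mod s

  row : ℕ → Fin r
  row i = i mod r

  -- neighbour list of a vertex in T(r,s,t), listed with multiplicity
  -- (0-indexed transcription of the paper's adjacency rules)
  nbrs : Vertex r s → List (Vertex r s)
  nbrs (i' , j') =
    if r ≡ᵇ 1 then
      ( (row i , plus j 1) ∷ (row i , minus j 1)
      ∷ (row i , plus j t) ∷ (row i , minus j t)
      ∷ (row i , plus j (t + 1)) ∷ (row i , minus j (t + 1)) ∷ [] )
    else if i ≡ᵇ 0 then
      ( (row i , plus j 1) ∷ (row i , minus j 1)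
      ∷ (row 1 , plus j 0) ∷ (row 1 , minus j 1)
      ∷ (row (r ∸ 1) , plus j (t + 1)) ∷ (row (r ∸ 1) , plus j t) ∷ [] )
    else if i ≡ᵇ r ∸ 1 then
      ( (row i , plus j 1) ∷ (row i , minus j 1)
      ∷ (row (i ∸ 1) , plus j 1) ∷ (row (i ∸ 1) , plus j 0)
      ∷ (row 0 , minus j t) ∷ (row 0 , minus j (t + 1)) ∷ [] )
    else
      ( (row i , plus j 1) ∷ (row i , minus j 1)
      ∷ (row (i + 1) , plus j 0) ∷ (row (i ∸ 1) , plus j 0)
      ∷ (row (i + 1) , minus j 1) ∷ (row (i ∸ 1) , plus j 1) ∷ [] )
    where
      i = toℕ i'
      j = toℕ j'

  mult : Vertex r s → Vertex r s → ℕ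
  mult u v = length (filter (λ w → w ≟V v) (nbrs u))

  IsAutomorphism : (Vertex r s → Vertex r s) → Set
  IsAutomorphism f =
    Bijective {A = Vertex r s} _≡_ _≡_ f × (∀ u v → mult (f u) (f v) ≡ mult u v)

-- the map (i , j) ↦ (r - i + 1 , s - j + 1)   (1-indexed), i.e. (i , j) ↦ (r-1-i , s-1-j) 0-indexed
reflectT : ∀ {r s} → Vertex r s → Vertex r s
reflectT (i , j) = opposite i , opposite j

-- The reflection ρ (i , j) = (r-1-i , s-1-j) is an involution, hence a bijection, so only
-- edge multiplicities need checking.  ρ exchanges the first and last rows, maps interior
-- rows to interior rows, and negates column offsets modulo s.  Consequently the neighbour
-- list of ρ u is the image under ρ of the neighbour list of u with the two entries of each
-- consecutive pair exchanged, and the multiplicities, which only count entries, agree.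
module Submission where

open import Data.Bool using (true; false; T)
open import Data.Unit using (tt)
open import Data.Nat
open import Data.Nat.Properties
open import Data.Nat.DivMod
open import Data.Nat.Divisibility using (_∣_; _∣0; ∣-reflexive; ∣m∣n⇒∣m+n; n∣m*n; n∣m⇒m%n≡0)
open import Algebra.Properties.CommutativeSemigroup +-commutativeSemigroup
  using (interchange; xy∙z≈xz∙y)
open import Data.Fin using (Fin; toℕ; opposite)
open import Data.Fin.Properties
  using (toℕ-injective; toℕ<n; toℕ-fromℕ<; opposite-prop; opposite-involutive)
open import Data.Product using (_,_; proj₁)
open import Data.List using (List; []; _∷_; map; filter; length)
open import Data.List.Relation.Binary.Pointwise using (Pointwise-≡⇒≡; []; _∷_)
open import Data.List.Relation.Binary.Permutation.Propositional using (_↭_; ↭-refl; swap)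
open import Data.List.Relation.Binary.Permutation.Propositional.Properties
  using (↭-length; filter-↭)
open import Relation.Nullary using (yes; no; contradiction)
open import Relation.Binary.Definitions using (DecidableEquality)
open import Relation.Binary.PropositionalEquality
open import Function.Definitions using (Injective; Bijective)
open import Function.Consequences.Propositional
  using (inverseᵇ⇒bijective; strictlyInverseˡ⇒inverseˡ; strictlyInverseʳ⇒inverseʳ)

open import Defs

open ≡-Reasoning

≡ᵇ≡true⇒≡ : ∀ {m n} → (m ≡ᵇ n) ≡ true → m ≡ n
≡ᵇ≡true⇒≡ {m} {n} m≡ᵇn = ≡ᵇ⇒≡ m n (subst T (sym m≡ᵇn) tt)

≡ᵇ≡false⇒≢ : ∀ {m n} → (m ≡ᵇ n) ≡ false → m ≢ n
≡ᵇ≡false⇒≢ {m} {n} m≢ᵇn m≡n = subst T m≢ᵇn (≡⇒≡ᵇ m n m≡n)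

≡ᵇ-complement : ∀ a b c d → a + b ≡ c + d → (a ≡ᵇ c) ≡ (b ≡ᵇ d)
≡ᵇ-complement a b c d a+b≡c+d with a ≡ᵇ c in a≟c | b ≡ᵇ d in b≟d
... | true  | true  = refl
... | false | false = refl
... | true  | false = contradiction
  (+-cancelˡ-≡ a b d (trans a+b≡c+d (cong (_+ d) (sym (≡ᵇ≡true⇒≡ a≟c))))) (≡ᵇ≡false⇒≢ b≟d)
... | false | true  = contradiction
  (+-cancelʳ-≡ b a c (trans a+b≡c+d (cong (c +_) (sym (≡ᵇ≡true⇒≡ b≟d))))) (≡ᵇ≡false⇒≢ a≟c)

m∸1+[n+1]≡m+n : ∀ {m} n → m ≢ 0 → m ∸ 1 + (n + 1) ≡ m + n
m∸1+[n+1]≡m+n {zero}  n m≢0 = contradiction refl m≢0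
m∸1+[n+1]≡m+n {suc m} n _   = trans (cong (m +_) (+-comm n 1)) (+-suc m n)

toℕ-opposite+toℕ : ∀ {n} (i : Fin n) → toℕ (opposite i) + toℕ i ≡ n ∸ 1
toℕ-opposite+toℕ {n} i = begin
  toℕ (opposite i) + toℕ i  ≡⟨ cong (_+ toℕ i) (opposite-prop i) ⟩
  n ∸ suc (toℕ i) + toℕ i   ≡⟨ cong (_+ toℕ i) (∸-+-assoc n 1 (toℕ i)) ⟨
  n ∸ 1 ∸ toℕ i + toℕ i     ≡⟨ m∸n+n≡m (∸-monoˡ-≤ 1 (toℕ<n i)) ⟩
  n ∸ 1                     ∎

toℕ≢n∸1⇒toℕ-opposite≢0 : ∀ {n} (i : Fin n) → toℕ i ≢ n ∸ 1 → toℕ (opposite i) ≢ 0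
toℕ≢n∸1⇒toℕ-opposite≢0 i i≢n-1 i*≡0 =
  i≢n-1 (trans (cong (_+ toℕ i) (sym i*≡0)) (toℕ-opposite+toℕ i))

module _ {d : ℕ} .{{_ : NonZero d}} where

  +-cong-% : ∀ {a a′ b b′} → a % d ≡ a′ % d → b % d ≡ b′ % d → (a + b) % d ≡ (a′ + b′) % d
  +-cong-% {a} {a′} {b} {b′} a≡a′ b≡b′ = begin
    (a + b) % d            ≡⟨ %-distribˡ-+ a b d ⟩
    (a % d + b % d) % d    ≡⟨ cong₂ (λ x y → (x + y) % d) a≡a′ b≡b′ ⟩
    (a′ % d + b′ % d) % d  ≡⟨ %-distribˡ-+ a′ b′ d ⟨
    (a′ + b′) % d          ∎

  d∣n+[d∸n%d] : ∀ n → d ∣ n + (d ∸ n % d)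
  d∣n+[d∸n%d] n = subst (d ∣_) regroup
    (∣m∣n⇒∣m+n (∣-reflexive (sym (m+[n∸m]≡n (m%n≤n n d)))) (n∣m*n (n / d)))
    where
    regroup : n % d + (d ∸ n % d) + n / d * d ≡ n + (d ∸ n % d)
    regroup = begin
      n % d + (d ∸ n % d) + n / d * d  ≡⟨ xy∙z≈xz∙y (n % d) _ _ ⟩
      n % d + n / d * d + (d ∸ n % d)  ≡⟨ cong (_+ (d ∸ n % d)) (m≡m%n+[m/n]*n n d) ⟨
      n + (d ∸ n % d)                  ∎

  %-cancelʳ-+ : ∀ a b n → (a + n) % d ≡ (b + n) % d → a % d ≡ b % d
  %-cancelʳ-+ a b n a+n≡b+n = begin
    a % d                        ≡⟨ %-remove-+ʳ a (d∣n+[d∸n%d] n) ⟨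
    (a + (n + (d ∸ n % d))) % d  ≡⟨ cong (_% d) (+-assoc a n _) ⟨
    (a + n + (d ∸ n % d)) % d    ≡⟨ +-cong-% a+n≡b+n refl ⟩
    (b + n + (d ∸ n % d)) % d    ≡⟨ cong (_% d) (+-assoc b n _) ⟩
    (b + (n + (d ∸ n % d))) % d  ≡⟨ %-remove-+ʳ b (d∣n+[d∸n%d] n) ⟩
    b % d                        ∎

  -- Both opposite (b mod d) and a mod d are the residue x with x + b ≡ d - 1 (mod d).
  opposite-mod : ∀ a b → d ∣ suc (a + b) → opposite (b mod d) ≡ a mod d
  opposite-mod a b d∣1+a+b = toℕ-injective (begin
    x              ≡⟨ m<n⇒m%n≡m (toℕ<n (opposite (b mod d))) ⟨
    x % d          ≡⟨ %-cancelʳ-+ x a b x+b≡a+b ⟩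
    a % d          ≡⟨ toℕ-fromℕ< _ ⟨
    toℕ (a mod d)  ∎)
    where
    x = toℕ (opposite (b mod d))
    x+b≡a+b : (x + b) % d ≡ (a + b) % d
    x+b≡a+b = begin
      (x + b) % d              ≡⟨ +-cong-% refl (trans (cong (_% d) (toℕ-fromℕ< _)) (m%n%n≡m%n b d)) ⟨
      (x + toℕ (b mod d)) % d  ≡⟨ cong (_% d) (toℕ-opposite+toℕ (b mod d)) ⟩
      (d ∸ 1) % d              ≡⟨ m<n⇒m%n≡m (≤-reflexive (suc-pred d)) ⟩
      d ∸ 1                    ≡⟨ %-pred-≡0 (n∣m⇒m%n≡0 _ d d∣1+a+b) ⟨
      (a + b) % d              ∎

swapPairs : ∀ {A : Set} → List A → List A
swapPairs (x ∷ y ∷ xs) = y ∷ x ∷ swapPairs xs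
swapPairs xs           = xs

swapPairs-↭ : ∀ {A : Set} (xs : List A) → swapPairs xs ↭ xs
swapPairs-↭ []           = ↭-refl
swapPairs-↭ (x ∷ [])     = ↭-refl
swapPairs-↭ (x ∷ y ∷ xs) = swap y x (swapPairs-↭ xs)

module _ {A B : Set} (_≟A_ : DecidableEquality A) (_≟B_ : DecidableEquality B)
         {f : A → B} (f-injective : Injective _≡_ _≡_ f) where

  length-filter-≟-map : ∀ v xs →
    length (filter (_≟B f v) (map f xs)) ≡ length (filter (_≟A v) xs)
  length-filter-≟-map v [] = refl
  length-filter-≟-map v (x ∷ xs) with f x ≟B f v | x ≟A v
  ... | yes _     | yes _   = cong suc (length-filter-≟-map v xs)
  ... | no _      | no _    = length-filter-≟-map v xs
  ... | yes fx≡fv | no x≢v  = contradiction (f-injective fx≡fv) x≢v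
  ... | no fx≢fv  | yes x≡v = contradiction (cong f x≡v) fx≢fv

reflectT-involutive : ∀ {r s} (u : Vertex r s) → reflectT (reflectT u) ≡ u
reflectT-involutive (i , j) = cong₂ _,_ (opposite-involutive i) (opposite-involutive j)

reflectT-bijective : ∀ {r s} → Bijective _≡_ _≡_ (reflectT {r} {s})
reflectT-bijective = inverseᵇ⇒bijective
  ( strictlyInverseˡ⇒inverseˡ reflectT reflectT-involutive
  , strictlyInverseʳ⇒inverseʳ reflectT reflectT-involutive )

module _ (r s t : ℕ) .{{_ : NonZero r}} .{{_ : NonZero s}} where

  opposite-row : ∀ a b → a + b ≡ r ∸ 1 → opposite (row r s t b) ≡ row r s t a
  opposite-row a b a+b≡r-1 =
    opposite-mod a b (∣-reflexive (sym (trans (cong suc a+b≡r-1) (suc-pred r))))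

  opposite-row-opposite : ∀ (i : Fin r) →
    opposite (row r s t (toℕ i)) ≡ row r s t (toℕ (opposite i))
  opposite-row-opposite i = opposite-row _ _ (toℕ-opposite+toℕ i)

  opposite-row-suc : ∀ a b → a + b ≡ r ∸ 1 → a ≢ 0 →
    opposite (row r s t (b + 1)) ≡ row r s t (a ∸ 1)
  opposite-row-suc a b a+b≡r-1 a≢0 =
    opposite-row (a ∸ 1) (b + 1) (trans (m∸1+[n+1]≡m+n b a≢0) a+b≡r-1)

  opposite-row-pred : ∀ a b → a + b ≡ r ∸ 1 → b ≢ 0 →
    opposite (row r s t (b ∸ 1)) ≡ row r s t (a + 1)
  opposite-row-pred a b a+b≡r-1 b≢0 = opposite-row (a + 1) (b ∸ 1) (begin
    a + 1 + (b ∸ 1)  ≡⟨ +-comm (a + 1) (b ∸ 1) ⟩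
    b ∸ 1 + (a + 1)  ≡⟨ m∸1+[n+1]≡m+n a b≢0 ⟩
    b + a            ≡⟨ +-comm b a ⟩
    a + b            ≡⟨ a+b≡r-1 ⟩
    r ∸ 1            ∎)

  opposite-shift : ∀ (j : Fin s) c e → s ∣ c + e →
    opposite ((toℕ j + e) mod s) ≡ (toℕ (opposite j) + c) mod s
  opposite-shift j c e s∣c+e = opposite-mod _ _
    (subst (s ∣_) (cong suc (sym (interchange (toℕ (opposite j)) c (toℕ j) e)))
      (∣m∣n⇒∣m+n (∣-reflexive (sym (trans (cong suc (toℕ-opposite+toℕ j)) (suc-pred s))))
                 s∣c+e))

  opposite-plus : ∀ (j : Fin s) e →
    opposite (plus r s t (toℕ j) e) ≡ minus r s t (toℕ (opposite j)) e
  opposite-plus j e = opposite-shift j _ e (subst (s ∣_) (+-comm e _) (d∣n+[d∸n%d] e))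

  opposite-minus : ∀ (j : Fin s) e →
    opposite (minus r s t (toℕ j) e) ≡ plus r s t (toℕ (opposite j)) e
  opposite-minus j e = opposite-shift j e _ (d∣n+[d∸n%d] e)

  opposite-plus-0 : ∀ (j : Fin s) →
    opposite (plus r s t (toℕ j) 0) ≡ plus r s t (toℕ (opposite j)) 0
  opposite-plus-0 j = opposite-shift j 0 0 (s ∣0)

  -- The rewrites turn the row tests of ρ u into the opposite tests on u: the first and
  -- last rows are exchanged.
  nbrs-reflectT : ∀ u → swapPairs (map reflectT (nbrs r s t u)) ≡ nbrs r s t (reflectT u)
  nbrs-reflectT (i , j)
    rewrite ≡ᵇ-complement (toℕ (opposite i)) (toℕ i) 0 (r ∸ 1) (toℕ-opposite+toℕ i)
          | ≡ᵇ-complement (toℕ (opposite i)) (toℕ i) (r ∸ 1) 0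
              (trans (toℕ-opposite+toℕ i) (sym (+-identityʳ (r ∸ 1))))
    with r ≡ᵇ 1 in r≟1
  ... | true = Pointwise-≡⇒≡
    ( cong₂ _,_ (opposite-row-opposite i) (opposite-minus j 1)
    ∷ cong₂ _,_ (opposite-row-opposite i) (opposite-plus j 1)
    ∷ cong₂ _,_ (opposite-row-opposite i) (opposite-minus j t)
    ∷ cong₂ _,_ (opposite-row-opposite i) (opposite-plus j t)
    ∷ cong₂ _,_ (opposite-row-opposite i) (opposite-minus j (t + 1))
    ∷ cong₂ _,_ (opposite-row-opposite i) (opposite-plus j (t + 1)) ∷ [])
  ... | false with toℕ i ≡ᵇ 0 in i≟0 | toℕ i ≡ᵇ r ∸ 1 in i≟r-1
  ...   | true  | true  = contradiction
    (trans (sym (suc-pred r)) (cong suc (trans (sym (≡ᵇ≡true⇒≡ {toℕ i} i≟r-1))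
                                               (≡ᵇ≡true⇒≡ {toℕ i} i≟0))))
    (≡ᵇ≡false⇒≢ r≟1)
  ...   | true  | false = Pointwise-≡⇒≡
    ( cong₂ _,_ (opposite-row-opposite i) (opposite-minus j 1)
    ∷ cong₂ _,_ (opposite-row-opposite i) (opposite-plus j 1)
    ∷ cong₂ _,_ second-row (opposite-minus j 1)
    ∷ cong₂ _,_ second-row (opposite-plus-0 j)
    ∷ cong₂ _,_ last-row (opposite-plus j t)
    ∷ cong₂ _,_ last-row (opposite-plus j (t + 1)) ∷ [])
    where
    second-row : opposite (row r s t 1) ≡ row r s t (toℕ (opposite i) ∸ 1)
    second-row =
      subst (λ k → opposite (row r s t (k + 1)) ≡ row r s t (toℕ (opposite i) ∸ 1))
        (≡ᵇ≡true⇒≡ i≟0)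
        (opposite-row-suc _ _ (toℕ-opposite+toℕ i)
          (toℕ≢n∸1⇒toℕ-opposite≢0 i (≡ᵇ≡false⇒≢ i≟r-1)))
    last-row : opposite (row r s t (r ∸ 1)) ≡ row r s t 0
    last-row = opposite-row 0 (r ∸ 1) refl
  ...   | false | true  = Pointwise-≡⇒≡
    ( cong₂ _,_ (opposite-row-opposite i) (opposite-minus j 1)
    ∷ cong₂ _,_ (opposite-row-opposite i) (opposite-plus j 1)
    ∷ cong₂ _,_ second-row (opposite-plus-0 j)
    ∷ cong₂ _,_ second-row (opposite-plus j 1)
    ∷ cong₂ _,_ first-row (opposite-minus j (t + 1))
    ∷ cong₂ _,_ first-row (opposite-minus j t) ∷ [])
    where
    i*≡0 : toℕ (opposite i) ≡ 0
    i*≡0 = +-cancelʳ-≡ (toℕ i) _ 0 (trans (toℕ-opposite+toℕ i) (sym (≡ᵇ≡true⇒≡ i≟r-1)))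
    second-row : opposite (row r s t (toℕ i ∸ 1)) ≡ row r s t 1
    second-row = subst (λ k → opposite (row r s t (toℕ i ∸ 1)) ≡ row r s t (k + 1)) i*≡0
      (opposite-row-pred _ _ (toℕ-opposite+toℕ i) (≡ᵇ≡false⇒≢ i≟0))
    first-row : opposite (row r s t 0) ≡ row r s t (r ∸ 1)
    first-row = opposite-row (r ∸ 1) 0 (+-identityʳ (r ∸ 1))
  ...   | false | false = Pointwise-≡⇒≡
    ( cong₂ _,_ (opposite-row-opposite i) (opposite-minus j 1)
    ∷ cong₂ _,_ (opposite-row-opposite i) (opposite-plus j 1)
    ∷ cong₂ _,_ row-below (opposite-plus-0 j)
    ∷ cong₂ _,_ row-above (opposite-plus-0 j)
    ∷ cong₂ _,_ row-below (opposite-plus j 1)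
    ∷ cong₂ _,_ row-above (opposite-minus j 1) ∷ [])
    where
    row-below : opposite (row r s t (toℕ i ∸ 1)) ≡ row r s t (toℕ (opposite i) + 1)
    row-below = opposite-row-pred _ _ (toℕ-opposite+toℕ i) (≡ᵇ≡false⇒≢ i≟0)
    row-above : opposite (row r s t (toℕ i + 1)) ≡ row r s t (toℕ (opposite i) ∸ 1)
    row-above = opposite-row-suc _ _ (toℕ-opposite+toℕ i)
      (toℕ≢n∸1⇒toℕ-opposite≢0 i (≡ᵇ≡false⇒≢ i≟r-1))

  mult-reflectT : ∀ u v → mult r s t (reflectT u) (reflectT v) ≡ mult r s t u v
  mult-reflectT u v = begin
    length (filter (_≟V reflectT v) (nbrs r s t (reflectT u)))
      ≡⟨ cong (λ ws → length (filter (_≟V reflectT v) ws)) (nbrs-reflectT u) ⟨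
    length (filter (_≟V reflectT v) (swapPairs (map reflectT (nbrs r s t u))))
      ≡⟨ ↭-length (filter-↭ (_≟V reflectT v) (swapPairs-↭ (map reflectT (nbrs r s t u)))) ⟩
    length (filter (_≟V reflectT v) (map reflectT (nbrs r s t u)))
      ≡⟨ length-filter-≟-map _≟V_ _≟V_ (proj₁ reflectT-bijective) v (nbrs r s t u) ⟩
    mult r s t u v
      ∎

lemma5 : (r s t : ℕ) .{{_ : NonZero r}} .{{_ : NonZero s}} → t ≤ s ∸ 1 →
    IsAutomorphism r s t (reflectT {r} {s})
lemma5 r s t _ = reflectT-bijective , mult-reflectT r s t
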